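{- For every graph $G$, $\widetilde{\Delta}(G)\le\alpha^{\mathrm{loc}}(G)^{\widetilde{\omega}(G)}$.
   Context: All graphs finite and simple. Two vertices are equivalent if they lie in exactly the same maximal cliques (true twins); the clique-quotient graph $\widetilde{G}$ has the classes as vertices, two distinct classes adjacent iff their vertices are adjacent in $G$; $\widetilde{\Delta}(G)$ is the maximum degree of $\widetilde{G}$. $\widetilde{\omega}(G)$ is the maximum, over maximal cliques $K$ of $G$, of the number of classes intersecting $K$. $\alpha^{\mathrm{loc}}(G)=\max_v\alpha(G[N[v]])$ with $\alpha$ the independence number. -}

module Defs where

open import Data.Nat using (ℕ; _≤_)
open import Data.Fin using (Fin)
open import Data.Bool using (Bool; true; false; T)
open import Data.List using (List; length)
open import Data.List.Relation.Unary.All using (All)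
open import Data.List.Relation.Unary.AllPairs using (AllPairs)
open import Data.Product using (Σ; _×_; ∃)
open import Data.Sum using (_⊎_)
open import Relation.Nullary using (¬_)
open import Relation.Binary.PropositionalEquality using (_≡_; _≢_)

record Graph (n : ℕ) : Set where
  field
    adj    : Fin n → Fin n → Bool
    sym    : ∀ u v → adj u v ≡ adj v u
    irrefl : ∀ v → adj v v ≡ false

module _ {n : ℕ} (G : Graph n) where
  open Graph G

  Adj : Fin n → Fin n → Set
  Adj u v = T (adj u v)

  VSet : Set
  VSet = Fin n → Bool

  IsClique : VSet → Set
  IsClique K = ∀ u v → K u ≡ true → K v ≡ true → u ≢ v → Adj u v

  IsMaximalClique : VSet → Set
  IsMaximalClique K =
    IsClique K × (∀ v → K v ≡ false → ∃ λ u → K u ≡ true × ¬ Adj u v)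

  -- true twins: same maximal cliques
  Equiv : Fin n → Fin n → Set
  Equiv u v = ∀ K → IsMaximalClique K → K u ≡ K v

  -- m is the maximum of the natural numbers satisfying P (0 if none)
  IsMaxOf : (ℕ → Set) → ℕ → Set
  IsMaxOf P m = (∀ k → P k → k ≤ m) × (m ≡ 0 ⊎ P m)

  -- degree of the class [v] in the clique-quotient graph is at least k:
  -- there are k pairwise inequivalent vertices, none equivalent to v,
  -- all adjacent to v (i.e. k distinct classes adjacent to [v]).
  QDegAtLeast : Fin n → ℕ → Set
  QDegAtLeast v k = Σ (List (Fin n)) λ L →
    length L ≡ k × AllPairs (λ x y → ¬ Equiv x y) L
    × All (λ x → ¬ Equiv x v × Adj v x) L

  IsQuotMaxDeg : ℕ → Set
  IsQuotMaxDeg = IsMaxOf (λ k → ∃ λ v → QDegAtLeast v k)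

  ClassCliqueAtLeast : ℕ → Set
  ClassCliqueAtLeast k = Σ VSet λ K → IsMaximalClique K ×
    Σ (List (Fin n)) λ L → length L ≡ k
      × AllPairs (λ x y → ¬ Equiv x y) L × All (λ x → K x ≡ true) L

  IsQuotCliqueNumber : ℕ → Set
  IsQuotCliqueNumber = IsMaxOf ClassCliqueAtLeast

  InClosedNbhd : Fin n → Fin n → Set
  InClosedNbhd v x = x ≡ v ⊎ Adj v x

  LocIndepAtLeast : Fin n → ℕ → Set
  LocIndepAtLeast v k = Σ (List (Fin n)) λ L →
    length L ≡ k × AllPairs (λ x y → x ≢ y × ¬ Adj x y) L
    × All (InClosedNbhd v) L

  IsLocalIndepNumber : ℕ → Set
  IsLocalIndepNumber = IsMaxOf (λ k → ∃ λ v → LocIndepAtLeast v k)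

-- Fix v and pairwise inequivalent neighbours S of v outside its class. Starting from C = [v],
-- grow a list C of pairwise adjacent, pairwise inequivalent vertices to each of which every member
-- of S is adjacent and inequivalent. A maximal independent D ⊆ S has at most α^loc members, and
-- each s ∈ S equals or is adjacent to some x ∈ D; the neighbours of x in S keep the property for
-- x ∷ C. As C lies in a maximal clique meeting |C| classes, C grows at most ω̃ − 1 times, whence
-- d̃ ≤ a + a² + ⋯ + a^(ω̃−1) ≤ a^ω̃ when a ≥ 2. If a ≤ 1, a maximal clique K containing u but not a
-- neighbour v would give an independent pair {v, x} in N[u] (x ∈ K non-adjacent to v), so adjacent
-- vertices are twins and d̃ = 0.
module Submission where

open import Defs
open import Data.Bool using (T; true; false)
open import Data.Bool.Properties using (T?)
open import Data.Empty using (⊥-elim)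
open import Data.Fin using (Fin; _≟_)
open import Data.List using (List; []; _∷_; _++_; length; filter; allFin)
open import Data.List.Properties using (filter-all)
open import Data.List.Membership.Propositional using (_∈_; find)
open import Data.List.Membership.Propositional.Properties using (∈-filter⁻; ∈-++⁺ˡ; ∈-++⁺ʳ; ∈-allFin)
open import Data.List.Relation.Binary.Subset.Propositional using (_⊆_)
open import Data.List.Relation.Binary.Subset.Propositional.Properties
  using (⊆-trans; xs⊆x∷xs; ++⁺ʳ; ∈-∷⁺ʳ)
open import Data.List.Relation.Binary.Sublist.Propositional.Properties as Sublist using ()
open import Data.List.Relation.Unary.All as All using (All; []; _∷_)
open import Data.List.Relation.Unary.All.Properties as All using (¬Any⇒All¬; all-filter)
open import Data.List.Relation.Unary.Any using (Any; here; there; any?)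
open import Data.List.Relation.Unary.AllPairs as AllPairs using (AllPairs; []; _∷_)
open import Data.List.Relation.Unary.AllPairs.Properties as AllPairs using ()
open import Data.List.Relation.Unary.Unique.Propositional using (Unique)
open import Data.Nat using (ℕ; zero; suc; _+_; _*_; _∸_; _^_; _≤_; _≤?_; z≤n; s≤s)
open import Data.Nat.Properties
  using (≤-trans; ≤-reflexive; n≤1+n; m≤m+n; m≤n+m∸n; n≮n; ≰⇒>; +-suc; +-comm; +-identityʳ;
         *-suc; *-identityʳ; +-mono-≤; +-monoˡ-≤; +-monoʳ-≤; *-monoˡ-≤; *-monoʳ-≤; module ≤-Reasoning)
open import Data.Product using (Σ; ∃; _×_; _,_; proj₁; proj₂)
open import Data.Sum using (_⊎_; inj₁; inj₂)
open import Function using (_∘_; id)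
open import Level using (_⊔_)
open import Relation.Binary using (Rel; Reflexive; Symmetric; Decidable)
open import Relation.Binary.PropositionalEquality
open import Relation.Nullary
open import Relation.Nullary.Decidable using (toSum; _⊎-dec_; dec-true; decidable-stable)
open import Relation.Unary using (Pred; ∁) renaming (Decidable to Decidable₁)
open import Relation.Unary.Properties using (_∪?_; ∁?)

module _ {a} {A : Set a} where

  AllPairs-lookup : ∀ {r} {R : Rel A r} → Symmetric R → ∀ {xs x y} →
                    AllPairs R xs → x ∈ xs → y ∈ xs → x ≢ y → R x y
  AllPairs-lookup R-sym (_ ∷ _)   (here refl) (here refl) x≢y = ⊥-elim (x≢y refl)
  AllPairs-lookup R-sym (px ∷ _)  (here refl) (there y∈)  _   = All.lookup px y∈
  AllPairs-lookup R-sym (px ∷ _)  (there x∈)  (here refl) _   = R-sym (All.lookup px x∈)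
  AllPairs-lookup R-sym (_ ∷ pxs) (there x∈)  (there y∈)  x≢y = AllPairs-lookup R-sym pxs x∈ y∈ x≢y

  Unique-constant⇒length≤1 : ∀ {x : A} {xs} → Unique xs → All (_≡ x) xs → length xs ≤ 1
  Unique-constant⇒length≤1 {xs = []}        _                   _                 = z≤n
  Unique-constant⇒length≤1 {xs = _ ∷ []}    _                   _                 = s≤s z≤n
  Unique-constant⇒length≤1 {xs = _ ∷ _ ∷ _} ((y≢z ∷ _) ∷ _ ∷ _) (refl ∷ refl ∷ _) = ⊥-elim (y≢z refl)

  module _ {p q} {P : Pred A p} {Q : Pred A q} (P? : Decidable₁ P) (Q? : Decidable₁ Q) where

    length-filter-∪ : ∀ xs →
      length (filter (P? ∪? Q?) xs) ≤ length (filter P? xs) + length (filter Q? xs)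
    length-filter-∪ []       = z≤n
    length-filter-∪ (x ∷ xs) with ih ← length-filter-∪ xs | P? x | Q? x
    ... | yes _ | yes _ = s≤s (≤-trans ih (+-monoʳ-≤ _ (n≤1+n _)))
    ... | yes _ | no  _ = s≤s ih
    ... | no  _ | yes _ = ≤-trans (s≤s ih) (≤-reflexive (sym (+-suc _ _)))
    ... | no  _ | no  _ = ih

  length≤filter+filter∁ : ∀ {p} {P : Pred A p} (P? : Decidable₁ P) xs →
    length xs ≤ length (filter P? xs) + length (filter (∁? P?) xs)
  length≤filter+filter∁ {P = P} P? xs = begin
    length xs                                  ≡⟨ cong length (filter-all (P? ∪? ∁? P?) decided) ⟨
    length (filter (P? ∪? ∁? P?) xs)           ≤⟨ length-filter-∪ P? (∁? P?) xs ⟩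
    length (filter P? xs) + length (filter (∁? P?) xs) ∎
    where
    open ≤-Reasoning
    decided : All (λ x → P x ⊎ ¬ P x) xs
    decided = All.tabulate (λ {x} _ → toSum (P? x))

module _ {a b p} {A : Set a} {B : Set b} {P : A → Pred B p} (P? : ∀ x → Decidable₁ (P x)) where

  length≤*-of-cover : ∀ (xs : List A) {ys : List B} {m : ℕ} →
    All (λ y → Any (λ x → P x y) xs) ys →
    All (λ x → length (filter (P? x) ys) ≤ m) xs →
    length ys ≤ length xs * m
  length≤*-of-cover []       {[]}    _            _         = z≤n
  length≤*-of-cover []       {_ ∷ _} (() ∷ _)     _
  length≤*-of-cover (x ∷ xs) {ys} {m} covered (x-covers ∷ xs-cover) = begin
    length ys                                          ≤⟨ length≤filter+filter∁ (P? x) ys ⟩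
    length (filter (P? x) ys) + length uncovered-by-x  ≤⟨ +-mono-≤ x-covers rest ⟩
    m + length xs * m                                  ∎
    where
    open ≤-Reasoning
    uncovered-by-x = filter (∁? (P? x)) ys
    drop-x : ∀ {y} → Any (λ x′ → P x′ y) (x ∷ xs) × ∁ (P x) y → Any (λ x′ → P x′ y) xs
    drop-x (here Pxy  , ¬Pxy) = ⊥-elim (¬Pxy Pxy)
    drop-x (there any , _)    = any
    shrink : ∀ {x′} → length (filter (P? x′) ys) ≤ m → length (filter (P? x′) uncovered-by-x) ≤ m
    shrink {x′} = ≤-trans (Sublist.length-mono-≤
      (Sublist.filter⁺ (P? x′) (P? x′) (λ { refl Py → Py }) (Sublist.filter-⊆ (∁? (P? x)) ys)))
    rest : length uncovered-by-x ≤ length xs * m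
    rest = length≤*-of-cover xs
      (All.map drop-x (All.zip (All.filter⁺ (∁? (P? x)) covered , all-filter (∁? (P? x)) ys)))
      (All.map shrink xs-cover)

module MaximalIndependent {a r} {A : Set a} {R : Rel A r} (R? : Decidable R) (R-refl : Reflexive R) where

  record Extension (I₀ S : List A) : Set (a ⊔ r) where
    field
      members     : List A
      initial⊆    : I₀ ⊆ members
      ⊆initial++S : members ⊆ I₀ ++ S
      independent : AllPairs (λ x y → ¬ R x y) members
      dominating  : All (λ s → Any (R s) members) S

  extend : ∀ {I₀} → AllPairs (λ x y → ¬ R x y) I₀ → (S : List A) → Extension I₀ S
  extend I₀-independent [] = record
    { members = _ ; initial⊆ = id ; ⊆initial++S = ∈-++⁺ˡ
    ; independent = I₀-independent ; dominating = [] }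
  extend {I₀} I₀-independent (s ∷ S) with E ← extend I₀-independent S
    with any? (R? s) (Extension.members E)
  ... | yes s-dominated = record
    { members     = E.members
    ; initial⊆    = E.initial⊆
    ; ⊆initial++S = ⊆-trans E.⊆initial++S (++⁺ʳ I₀ (xs⊆x∷xs S s))
    ; independent = E.independent
    ; dominating  = s-dominated ∷ E.dominating }
    where module E = Extension E
  ... | no s-free = record
    { members     = s ∷ E.members
    ; initial⊆    = there ∘ E.initial⊆
    ; ⊆initial++S = ∈-∷⁺ʳ (∈-++⁺ʳ I₀ (here refl))
                          (⊆-trans E.⊆initial++S (++⁺ʳ I₀ (xs⊆x∷xs S s)))
    ; independent = ¬Any⇒All¬ _ s-free ∷ E.independent
    ; dominating  = here R-refl ∷ All.map there E.dominating }
    where module E = Extension E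

-- Horner form of a + a² + ⋯ + aᵏ.
powerSum : ℕ → ℕ → ℕ
powerSum a zero    = 0
powerSum a (suc k) = a * suc (powerSum a k)

powerSum+a≤^ : ∀ {a} → 2 ≤ a → ∀ k → powerSum a k + a ≤ a ^ suc k
powerSum+a≤^ {a} 2≤a zero    = ≤-reflexive (sym (*-identityʳ a))
powerSum+a≤^ {a} 2≤a (suc k) = begin
  a * suc (powerSum a k) + a  ≡⟨ +-comm (a * suc (powerSum a k)) a ⟩
  a + a * suc (powerSum a k)  ≡⟨ *-suc a (suc (powerSum a k)) ⟨
  a * (2 + powerSum a k)      ≤⟨ *-monoʳ-≤ a (+-monoˡ-≤ (powerSum a k) 2≤a) ⟩
  a * (a + powerSum a k)      ≡⟨ cong (a *_) (+-comm a (powerSum a k)) ⟩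
  a * (powerSum a k + a)      ≤⟨ *-monoʳ-≤ a (powerSum+a≤^ 2≤a k) ⟩
  a * a ^ suc k               ∎
  where open ≤-Reasoning

powerSum-pred≤^ : ∀ {a} → 2 ≤ a → ∀ w → powerSum a (w ∸ 1) ≤ a ^ w
powerSum-pred≤^ 2≤a zero    = z≤n
powerSum-pred≤^ 2≤a (suc w) = ≤-trans (m≤m+n _ _) (powerSum+a≤^ 2≤a w)

module _ {n : ℕ} (G : Graph n) where

  open import Data.List.Membership.DecPropositional (_≟_ {n}) using (_∈?_)

  adj? : Decidable (Adj G)
  adj? u v = T? (Graph.adj G u v)

  Adj-sym : Symmetric (Adj G)
  Adj-sym {u} {v} = subst T (Graph.sym G u v)

  Adj-irrefl : ∀ {u} → ¬ Adj G u u
  Adj-irrefl {u} = subst T (Graph.irrefl G u)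

  Adj⇒≢ : ∀ {u v} → Adj G u v → u ≢ v
  Adj⇒≢ u~u refl = Adj-irrefl u~u

  ¬Equiv-sym : Symmetric (λ u v → ¬ Equiv G u v)
  ¬Equiv-sym u≁v v≈u = u≁v (λ K K-max → sym (v≈u K K-max))

  -- A clique is an independent set of the relation "equal or non-adjacent".
  private
    module Clique = MaximalIndependent {R = λ s x → s ≡ x ⊎ ¬ Adj G x s}
      (λ s x → (s ≟ x) ⊎-dec ¬? (adj? x s)) (inj₁ refl)

  clique⊆maximalClique : ∀ {C} → AllPairs (Adj G) C →
    Σ (VSet G) λ K → IsMaximalClique G K × All (λ x → K x ≡ true) C
  clique⊆maximalClique {C} C-clique = K , (K-clique , K-maximal) , All.tabulate (∈⇒K ∘ initial⊆)
    where
    separated : ∀ {x y} → Adj G x y → ¬ (x ≡ y ⊎ ¬ Adj G y x)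
    separated x~y (inj₁ x≡y) = Adj⇒≢ x~y x≡y
    separated x~y (inj₂ y≁x) = y≁x (Adj-sym x~y)
    open Clique.Extension (Clique.extend (AllPairs.map separated C-clique) (allFin n))
    K : VSet G
    K u = does (u ∈? members)
    ∈⇒K : ∀ {u} → u ∈ members → K u ≡ true
    ∈⇒K = dec-true (_ ∈? members)
    K⇒∈ : ∀ {u} → K u ≡ true → u ∈ members
    K⇒∈ {u} Ku with u ∈? members | Ku
    ... | yes u∈ | _ = u∈
    ... | no _   | ()
    adjacent : ∀ {x y} → ¬ (x ≡ y ⊎ ¬ Adj G y x) → Adj G x y
    adjacent x≉y = Adj-sym (decidable-stable (adj? _ _) (x≉y ∘ inj₂))
    K-clique : IsClique G K
    K-clique u v Ku Kv = AllPairs-lookup Adj-sym (AllPairs.map adjacent independent) (K⇒∈ Ku) (K⇒∈ Kv)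
    K-maximal : ∀ v → K v ≡ false → ∃ λ u → K u ≡ true × ¬ Adj G u v
    K-maximal v Kv with find (All.lookup dominating (∈-allFin v))
    ... | u , u∈ , inj₁ refl = contradiction (trans (sym (∈⇒K u∈)) Kv) λ ()
    ... | u , u∈ , inj₂ u≁v  = u , ∈⇒K u∈ , u≁v

  inClosedNbhd? : ∀ x → Decidable₁ (InClosedNbhd G x)
  inClosedNbhd? x = (_≟ x) ∪? adj? x

  private
    module Independent = MaximalIndependent {R = λ s x → InClosedNbhd G x s}
      (λ s x → inClosedNbhd? x s) (inj₁ refl)

  independentDominatingSublist : (S : List (Fin n)) → Σ (List (Fin n)) λ D → D ⊆ S
    × AllPairs (λ x y → x ≢ y × ¬ Adj G x y) D × All (λ s → Any (λ x → InClosedNbhd G x s) D) S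
  independentDominatingSublist S =
    members , ⊆initial++S , AllPairs.map nonadjacent independent , dominating
    where
    open Independent.Extension (Independent.extend [] S)
    nonadjacent : ∀ {x y} → ¬ InClosedNbhd G y x → x ≢ y × ¬ Adj G x y
    nonadjacent x∉N[y] = x∉N[y] ∘ inj₁ , x∉N[y] ∘ inj₂ ∘ Adj-sym

  separatedByMaximalClique⇒independentPair : ∀ {K u v} → IsMaximalClique G K → Adj G u v →
    K u ≡ true → K v ≡ false → LocIndepAtLeast G u 2
  separatedByMaximalClique⇒independentPair {K} {u} {v} (K-clique , K-maximal) u~v Ku Kv
    with x , Kx , x≁v ← K-maximal v Kv =
    v ∷ x ∷ [] , refl , ((v≢x , x≁v ∘ Adj-sym) ∷ []) ∷ [] ∷ [] , inj₂ u~v ∷ inj₂ u~x ∷ []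
    where
    v≢x : v ≢ x
    v≢x refl = contradiction (trans (sym Kx) Kv) λ ()
    u~x : Adj G u x
    u~x = K-clique u x Ku Kx (λ { refl → x≁v u~v })

  adjacent⇒Equiv : (∀ u → ¬ LocIndepAtLeast G u 2) → ∀ {u v} → Adj G u v → Equiv G u v
  adjacent⇒Equiv no-pair {u} {v} u~v K K-max with K u in Ku | K v in Kv
  ... | true  | true  = refl
  ... | false | false = refl
  ... | true  | false = ⊥-elim (no-pair u (separatedByMaximalClique⇒independentPair K-max u~v Ku Kv))
  ... | false | true  = ⊥-elim (no-pair v (separatedByMaximalClique⇒independentPair K-max (Adj-sym u~v) Kv Ku))

  module _ {a w : ℕ}
    (α-bound : ∀ k → (∃ λ v → LocIndepAtLeast G v k) → k ≤ a)
    (ω-bound : ∀ k → ClassCliqueAtLeast G k → k ≤ w)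
    (v : Fin n) where

    Joined : Fin n → Fin n → Set
    Joined x y = ¬ Equiv G x y × Adj G x y

    classClique-length≤ω : ∀ {C} → AllPairs Joined C → length C ≤ w
    classClique-length≤ω {C} C-clique
      with K , K-max , C⊆K ← clique⊆maximalClique (AllPairs.map proj₂ C-clique) =
      ω-bound (length C) (K , K-max , C , refl , AllPairs.map proj₁ C-clique , C⊆K)

    Extends : List (Fin n) → Fin n → Set
    Extends C s = Adj G v s × All (Joined s) C

    extensions-length≤powerSum : ∀ k {C S} → AllPairs Joined C → w ≤ length C + k →
      AllPairs (λ x y → ¬ Equiv G x y) S → (∀ {s} → s ∈ S → Extends C s) →
      length S ≤ powerSum a k
    extensions-length≤powerSum zero {C} {[]}    _        _   _ _      = z≤n
    extensions-length≤powerSum zero {C} {s ∷ _} C-clique w≤C _ extends =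
      ⊥-elim (n≮n (length C) (begin-strict
        length C         <⟨ classClique-length≤ω (proj₂ (extends (here refl)) ∷ C-clique) ⟩
        w                ≤⟨ w≤C ⟩
        length C + 0     ≡⟨ +-identityʳ (length C) ⟩
        length C         ∎))
      where open ≤-Reasoning
    extensions-length≤powerSum (suc k) {C} {S} C-clique w≤C S-classes extends
      with D , D⊆S , D-independent , D-dominating ← independentDominatingSublist S = begin
        length S                         ≤⟨ length≤*-of-cover inClosedNbhd? D D-dominating
                                              (All.tabulate (closedNbhd-bound ∘ D⊆S)) ⟩
        length D * suc (powerSum a k)    ≤⟨ *-monoˡ-≤ _ (α-bound _ (v , D , refl , D-independent ,
                                              All.tabulate (inj₂ ∘ proj₁ ∘ extends ∘ D⊆S))) ⟩
        a * suc (powerSum a k)           ∎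
      where
      open ≤-Reasoning
      closedNbhd-bound : ∀ {x} → x ∈ S → length (filter (inClosedNbhd? x) S) ≤ suc (powerSum a k)
      closedNbhd-bound {x} x∈S = begin
        length (filter (inClosedNbhd? x) S)                     ≤⟨ length-filter-∪ (_≟ x) (adj? x) S ⟩
        length (filter (_≟ x) S) + length (filter (adj? x) S)   ≤⟨ +-mono-≤ at-most-x neighbours ⟩
        1 + powerSum a k                                        ∎
        where
        at-most-x : length (filter (_≟ x) S) ≤ 1
        at-most-x = Unique-constant⇒length≤1
          (AllPairs.filter⁺ (_≟ x) (AllPairs.map (λ s≁t s≡t → s≁t (λ _ _ → cong _ s≡t)) S-classes))
          (all-filter (_≟ x) S)
        extends-x∷C : ∀ {s} → s ∈ filter (adj? x) S → Extends (x ∷ C) s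
        extends-x∷C s∈ with s∈S , x~s ← ∈-filter⁻ (adj? x) s∈ =
          proj₁ (extends s∈S) ,
          (AllPairs-lookup ¬Equiv-sym S-classes s∈S x∈S (Adj⇒≢ (Adj-sym x~s)) , Adj-sym x~s)
          ∷ proj₂ (extends s∈S)
        neighbours : length (filter (adj? x) S) ≤ powerSum a k
        neighbours = extensions-length≤powerSum k (proj₂ (extends x∈S) ∷ C-clique)
          (≤-trans w≤C (≤-reflexive (+-suc (length C) k)))
          (AllPairs.filter⁺ (adj? x) S-classes) extends-x∷C

    classNeighbours-length≤powerSum : ∀ {L} → AllPairs (λ x y → ¬ Equiv G x y) L →
      All (λ x → ¬ Equiv G x v × Adj G v x) L → length L ≤ powerSum a (w ∸ 1)
    classNeighbours-length≤powerSum {L} L-classes L-neighbours =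
      extensions-length≤powerSum (w ∸ 1) ([] ∷ []) (m≤n+m∸n w 1) L-classes extends-v
      where
      extends-v : ∀ {x} → x ∈ L → Extends (v ∷ []) x
      extends-v x∈L with x≁v , v~x ← All.lookup L-neighbours x∈L = v~x , (x≁v , Adj-sym v~x) ∷ []

lemma5p2 : ∀ {n : ℕ} (G : Graph n) (d a w : ℕ)
    → IsQuotMaxDeg G d → IsLocalIndepNumber G a → IsQuotCliqueNumber G w
    → d ≤ a ^ w
lemma5p2 G _ a w (_ , inj₁ refl) _ _ = z≤n
lemma5p2 G _ a w (_ , inj₂ (v , L , refl , L-classes , L-neighbours)) (α-bound , _) (ω-bound , _)
  with a ≤? 1 | L-neighbours
... | yes a≤1 | []                = z≤n
... | yes a≤1 | (x≁v , v~x) ∷ _   = ⊥-elim (x≁v (adjacent⇒Equiv G no-pair (Adj-sym G v~x)))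
  where
  no-pair : ∀ u → ¬ LocIndepAtLeast G u 2
  no-pair u pair with s≤s () ← ≤-trans (α-bound 2 (u , pair)) a≤1
... | no a≰1  | _                 =
  ≤-trans (classNeighbours-length≤powerSum G α-bound ω-bound v L-classes L-neighbours)
          (powerSum-pred≤^ (≰⇒> a≰1) w)
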